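{- Let $G$ be a connected identifiable graph of order $n$ (so $n\geq 3$). Then $\gamma_t^{\mathrm{ID}}(G)\leq n-1$, unless $G$ is the path $P_3$ (for which $\gamma_t^{\mathrm{ID}}(P_3)=3$).
   Context: All graphs are finite, simple and undirected. For a vertex $v$, $N(v)$ is its open neighbourhood and $N[v]=N(v)\cup\{v\}$ its closed neighbourhood. For a set $C\subseteq V(G)$ and vertex $v$, let $I(v)=N[v]\cap C$. A set $C$ is a separating code if $I(u)\neq I(v)$ for all distinct vertices $u,v$. A total dominating identifying code of $G$ is a separating code $C$ such that every vertex of $G$ has a neighbour in $C$. A graph is identifiable if it has no two distinct vertices $u,v$ with $N[u]=N[v]$ and it has no isolated vertices (i.e. it admits a total dominating identifying code). $\gamma_t^{\mathrm{ID}}(G)$ denotes the minimum size of a total dominating identifying code of an identifiable graph $G$. -}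

module Defs where

open import Data.Nat using (ℕ; _≤_; _∸_)
open import Data.Bool using (Bool; true; false; _∨_)
open import Data.Fin using (Fin; zero; suc)
open import Data.Fin.Properties using () renaming (_≟_ to _≟ᶠ_)
open import Data.Fin.Subset using (Subset; _∈_; _∩_; ∣_∣)
open import Data.Vec using (tabulate)
open import Data.Product using (Σ; ∃; _×_)
open import Relation.Nullary using (¬_)
open import Relation.Nullary.Decidable using (⌊_⌋)
open import Relation.Binary.PropositionalEquality using (_≡_; _≢_)
open import Function.Bundles using (_↔_; Inverse)

record Graph (n : ℕ) : Set where
  field
    adj    : Fin n → Fin n → Bool
    sym    : ∀ u v → adj u v ≡ adj v u
    irrefl : ∀ v → adj v v ≡ false
open Graph public

module _ {n : ℕ} (G : Graph n) where

  Adj : Fin n → Fin n → Set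
  Adj u v = adj G u v ≡ true

  N[_] : Fin n → Subset n
  N[ v ] = tabulate (λ u → ⌊ u ≟ᶠ v ⌋ ∨ adj G v u)

  I : Subset n → Fin n → Subset n
  I C v = N[ v ] ∩ C

  IsSeparatingCode : Subset n → Set
  IsSeparatingCode C = ∀ u v → u ≢ v → I C u ≢ I C v

  IsTotalDominating : Subset n → Set
  IsTotalDominating C = ∀ v → ∃ λ w → w ∈ C × Adj v w

  IsTDIdCode : Subset n → Set
  IsTDIdCode C = IsSeparatingCode C × IsTotalDominating C

  Identifiable : Set
  Identifiable = (∀ u v → u ≢ v → N[ u ] ≢ N[ v ]) × (∀ v → ∃ λ w → Adj v w)

  data Reach : Fin n → Fin n → Set where
    here : ∀ {v} → Reach v v
    step : ∀ {u w v} → Adj u w → Reach w v → Reach u v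

  Connected : Set
  Connected = ∀ u v → Reach u v

P3 : Graph 3
P3 = record { adj = a ; sym = s ; irrefl = i }
  where
  a : Fin 3 → Fin 3 → Bool
  a zero (suc zero) = true
  a (suc zero) zero = true
  a (suc zero) (suc (suc zero)) = true
  a (suc (suc zero)) (suc zero) = true
  a _ _ = false
  s : ∀ u v → a u v ≡ a v u
  s zero zero = _≡_.refl
  s zero (suc zero) = _≡_.refl
  s zero (suc (suc zero)) = _≡_.refl
  s (suc zero) zero = _≡_.refl
  s (suc zero) (suc zero) = _≡_.refl
  s (suc zero) (suc (suc zero)) = _≡_.refl
  s (suc (suc zero)) zero = _≡_.refl
  s (suc (suc zero)) (suc zero) = _≡_.refl
  s (suc (suc zero)) (suc (suc zero)) = _≡_.refl
  i : ∀ v → a v v ≡ false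
  i zero = _≡_.refl
  i (suc zero) = _≡_.refl
  i (suc (suc zero)) = _≡_.refl

_≅_ : ∀ {n m} → Graph n → Graph m → Set
_≅_ {n} {m} G H = Σ (Fin n ↔ Fin m) λ f →
  ∀ u v → adj G u v ≡ adj H (Inverse.to f u) (Inverse.to f v)

-- For n ≥ 4 the code is V(G) ∖ {v} for a suitable vertex v. If the support s of some leaf l has
-- at most one further neighbour w, take v = l: a pair of vertices that V ∖ {l} fails to separate
-- forces {l, s, w} to be a whole component, impossible when G is connected of order at least 4.
-- Otherwise, by Bondy's theorem some coordinate v can be deleted from the closed neighbourhoods
-- without identifying two distinct ones; replacing the closed neighbourhood of each leaf by the open
-- neighbourhood of its support keeps v off the supports, so V ∖ {v} is total dominating, and it
-- separates the non-leaves by the choice of v and the leaves because no support has degree two.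
-- Orders 1 and 2 admit no identifiable graph, and on 3 vertices only P3 remains, which needs all
-- three vertices.

module Submission where

open import Defs hiding (sym)
open import Data.Bool using (Bool; true; false; _∨_)
import Data.Bool.Properties as Bool
open import Data.Empty using (⊥)
open import Data.Fin using (Fin; zero; suc; punchIn; punchOut; _≟_)
open import Data.Fin.Patterns using (0F; 1F; 2F)
open import Data.Fin.Permutation using (Permutation; _⟨$⟩ʳ_; id; transpose; ↔⇒≡)
open import Data.Fin.Properties using (any?; all?; punchIn-punchOut; punchInᵢ≢i; injective⇒≤)
open import Data.Fin.Subset using (Subset; _∈_; _∉_; _⊆_; _∩_; ∁; ⁅_⁆; ⊤; ∣_∣)
open import Data.Fin.Subset.Properties
  using (⊆-antisym; _∈?_; x∈p∩q⁺; x∈p∩q⁻; x∉p⇒x∈∁p; x≢y⇒x∉⁅y⁆; ∣∁p∣≡n∸∣p∣; ∣⁅x⁆∣≡1; ∈⊤; ∣⊤∣≡n; ∩-identityʳ)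
open import Data.Nat using (ℕ; zero; suc; _≤_; _<_; _∸_; z≤n; s≤s)
open import Data.Nat.Properties using (≤-refl; ≤-reflexive; <⇒≱; m≤m+n)
open import Data.Product using (∃; _×_; _,_; proj₁; proj₂)
open import Data.Sum using (_⊎_; inj₁; inj₂; map₂)
open import Data.Vec using (Vec; _∷_; []; head; tail; removeAt; lookup; tabulate; there)
open import Data.Vec.Properties using (≡-dec; ∷-injective; lookup∘tabulate; tabulate-cong; []=⇒lookup; lookup⇒[]=)
open import Function using (_∘_; case_of_)
open import Relation.Binary.Definitions using (DecidableEquality)
open import Relation.Binary.PropositionalEquality
  using (_≡_; _≢_; refl; sym; trans; cong; cong₂; subst; module ≡-Reasoning)
open import Relation.Nullary using (¬_; Dec; yes; no; contradiction)
open import Relation.Nullary.Decidable using (⌊_⌋; _×-dec_; _⊎-dec_; _→-dec_; ¬?; decidable-stable; True; toWitness)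

-- Bondy's theorem

module _ {a} {A : Set a} where

  RemovableAt : ∀ {m k} → (Fin m → Vec A (suc k)) → Fin (suc k) → Set a
  RemovableAt f y = ∀ i j → removeAt (f i) y ≡ removeAt (f j) y → f i ≡ f j

  removeAt-zero : ∀ {k} (xs : Vec A (suc k)) → removeAt xs zero ≡ tail xs
  removeAt-zero (x ∷ xs) = refl

  removeAt-suc : ∀ {k} (xs : Vec A (suc (suc k))) (y : Fin (suc k)) →
                 removeAt xs (suc y) ≡ head xs ∷ removeAt (tail xs) y
  removeAt-suc (x ∷ x′ ∷ xs) y = refl

  head-tail-injective : ∀ {k} {xs ys : Vec A (suc k)} →
                        head xs ≡ head ys → tail xs ≡ tail ys → xs ≡ ys
  head-tail-injective {xs = x ∷ xs} {y ∷ ys} = cong₂ _∷_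

  tail-removable-lift :
    ∀ {m k} (f : Fin (suc m) → Vec A (suc (suc k))) {i j} →
    tail (f i) ≡ tail (f j) → f i ≢ f j →
    ∀ {y} → RemovableAt (λ c → tail (f (punchIn i c))) y → RemovableAt f (suc y)
  tail-removable-lift {m} f {i} {j} tails≡ fi≢fj {y} removable a b removed≡ =
    head-tail-injective heads≡ (begin
      tail (f a)     ≡⟨ proj₂ (other-row a) ⟩
      tail (f (ι a)) ≡⟨ removable _ _ rests≡ ⟩
      tail (f (ι b)) ≡⟨ sym (proj₂ (other-row b)) ⟩
      tail (f b)     ∎)
    where
    open ≡-Reasoning
    -- row i shares its tail with row j, so every tail is already the tail of a row other than i
    other-row : ∀ a → ∃ λ c → tail (f a) ≡ tail (f (punchIn i c))
    other-row a with a ≟ i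
    ... | yes refl = punchOut (fi≢fj ∘ cong f) , trans tails≡ (cong (tail ∘ f) (sym (punchIn-punchOut _)))
    ... | no a≢i   = punchOut (a≢i ∘ sym) , cong (tail ∘ f) (sym (punchIn-punchOut _))
    ι : Fin (suc m) → Fin (suc m)
    ι a = punchIn i (proj₁ (other-row a))
    split : head (f a) ≡ head (f b) × removeAt (tail (f a)) y ≡ removeAt (tail (f b)) y
    split = ∷-injective (trans (sym (removeAt-suc (f a) y)) (trans removed≡ (removeAt-suc (f b) y)))
    heads≡ : head (f a) ≡ head (f b)
    heads≡ = proj₁ split
    rests≡ : removeAt (tail (f (ι a))) y ≡ removeAt (tail (f (ι b))) y
    rests≡ = trans (cong (λ v → removeAt v y) (sym (proj₂ (other-row a))))
               (trans (proj₂ split) (cong (λ v → removeAt v y) (proj₂ (other-row b))))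

  bondy : DecidableEquality A → ∀ k {m} (f : Fin m → Vec A (suc k)) → m ≤ suc k → ∃ (RemovableAt f)
  bondy _≟ₐ_ zero {zero}        f _       = zero , λ ()
  bondy _≟ₐ_ zero {suc zero}    f _       = zero , λ { zero zero _ → refl }
  bondy _≟ₐ_ zero {suc (suc m)} f (s≤s ())
  bondy _≟ₐ_ (suc k) {m} f m≤ with collision?
    where
    _≟ᵥ_ : ∀ {l} → DecidableEquality (Vec A l)
    _≟ᵥ_ = ≡-dec _≟ₐ_
    collision? : Dec (∃ λ i → ∃ λ j → tail (f i) ≡ tail (f j) × f i ≢ f j)
    collision? = any? (λ i → any? (λ j → (tail (f i) ≟ᵥ tail (f j)) ×-dec ¬? (f i ≟ᵥ f j)))
  ... | no noCollision = zero , λ i j removed≡ → decidable-stable (≡-dec _≟ₐ_ (f i) (f j)) λ fi≢fj →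
          noCollision (i , j , tails≡ i j removed≡ , fi≢fj)
    where
    tails≡ : ∀ i j → removeAt (f i) zero ≡ removeAt (f j) zero → tail (f i) ≡ tail (f j)
    tails≡ i j removed≡ = trans (sym (removeAt-zero (f i))) (trans removed≡ (removeAt-zero (f j)))
  bondy _≟ₐ_ (suc k) {suc m} f (s≤s m≤) | yes (i , j , tails≡ , fi≢fj) =
    let y , removable = bondy _≟ₐ_ k (λ c → tail (f (punchIn i c))) m≤
    in suc y , tail-removable-lift f tails≡ fi≢fj removable

module _ {n : ℕ} where

  ∈-tabulate⁺ : ∀ {f : Fin n → Bool} {z} → f z ≡ true → z ∈ tabulate f
  ∈-tabulate⁺ {f} {z} fz = lookup⇒[]= z (tabulate f) (trans (lookup∘tabulate f z) fz)

  ∈-tabulate⁻ : ∀ {f : Fin n → Bool} {z} → z ∈ tabulate f → f z ≡ true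
  ∈-tabulate⁻ {f} {z} z∈ = trans (sym (lookup∘tabulate f z)) ([]=⇒lookup z∈)

  ∈∁⁅⁆ : ∀ {v z : Fin n} → z ≢ v → z ∈ ∁ ⁅ v ⁆
  ∈∁⁅⁆ = x∉p⇒x∈∁p ∘ x≢y⇒x∉⁅y⁆

  ∣∁⁅⁆∣ : (v : Fin n) → ∣ ∁ ⁅ v ⁆ ∣ ≡ n ∸ 1
  ∣∁⁅⁆∣ v = trans (∣∁p∣≡n∸∣p∣ ⁅ v ⁆) (cong (n ∸_) (∣⁅x⁆∣≡1 v))

lookup-removeAt : ∀ {a} {A : Set a} {n} (xs : Vec A (suc n)) i j →
                  lookup (removeAt xs i) j ≡ lookup xs (punchIn i j)
lookup-removeAt (x ∷ xs)     zero    j       = refl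
lookup-removeAt (x ∷ y ∷ xs) (suc i) zero    = refl
lookup-removeAt (x ∷ y ∷ xs) (suc i) (suc j) = lookup-removeAt (y ∷ xs) i j

module _ {n : ℕ} (i : Fin (suc n)) where

  ∈-removeAt⁻ : ∀ {p : Subset (suc n)} {z} → z ∈ removeAt p i → punchIn i z ∈ p
  ∈-removeAt⁻ {p} {z} z∈ = lookup⇒[]= _ p (trans (sym (lookup-removeAt p i z)) ([]=⇒lookup z∈))

  ∈-removeAt⁺ : ∀ {p : Subset (suc n)} {z} → punchIn i z ∈ p → z ∈ removeAt p i
  ∈-removeAt⁺ {p} {z} z∈ = lookup⇒[]= z (removeAt p i) (trans (lookup-removeAt p i z) ([]=⇒lookup z∈))

  removeAt-≡ : ∀ {p q : Subset (suc n)} →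
               (∀ {z} → z ≢ i → z ∈ p → z ∈ q) → (∀ {z} → z ≢ i → z ∈ q → z ∈ p) →
               removeAt p i ≡ removeAt q i
  removeAt-≡ p→q q→p = ⊆-antisym (transfer p→q) (transfer q→p)
    where
    transfer : ∀ {r s : Subset (suc n)} → (∀ {z} → z ≢ i → z ∈ r → z ∈ s) → removeAt r i ⊆ removeAt s i
    transfer r→s z∈ = ∈-removeAt⁺ (r→s (punchInᵢ≢i i _) (∈-removeAt⁻ z∈))

-- Neighbourhoods, leaves and punctured codes

module _ {n : ℕ} (G : Graph n) where

  Adj-sym : ∀ {x y} → Adj G x y → Adj G y x
  Adj-sym {x} {y} = trans (Graph.sym G y x)

  Adj-irrefl : ∀ {x} → ¬ Adj G x x
  Adj-irrefl {x} xx = contradiction (trans (sym xx) (irrefl G x)) λ ()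

  Adj? : ∀ x y → Dec (Adj G x y)
  Adj? x y = adj G x y Bool.≟ true

  N⟨_⟩ : Fin n → Subset n
  N⟨ x ⟩ = tabulate (adj G x)

  ∈N⟨⟩⁺ : ∀ {x z} → Adj G x z → z ∈ N⟨ x ⟩
  ∈N⟨⟩⁺ {x} = ∈-tabulate⁺ {f = adj G x}

  ∈N⟨⟩⁻ : ∀ {x z} → z ∈ N⟨ x ⟩ → Adj G x z
  ∈N⟨⟩⁻ {x} = ∈-tabulate⁻ {f = adj G x}

  ∈N[]⁺ : ∀ {x z} → z ≡ x ⊎ Adj G x z → z ∈ N[ G ] x
  ∈N[]⁺ {x} {z} z∼x = ∈-tabulate⁺ (closed z∼x)
    where
    closed : z ≡ x ⊎ Adj G x z → ⌊ z ≟ x ⌋ ∨ adj G x z ≡ true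
    closed z∼x with z ≟ x | z∼x
    ... | yes _   | _         = refl
    ... | no z≢x  | inj₁ z≡x  = contradiction z≡x z≢x
    ... | no _    | inj₂ xz   = xz

  ∈N[]⁻ : ∀ {x z} → z ∈ N[ G ] x → z ≡ x ⊎ Adj G x z
  ∈N[]⁻ {x} {z} z∈ with z ≟ x | ∈-tabulate⁻ z∈
  ... | yes z≡x | _  = inj₁ z≡x
  ... | no _    | xz = inj₂ xz

  ∈N[]-refl : ∀ {x} → x ∈ N[ G ] x
  ∈N[]-refl = ∈N[]⁺ (inj₁ refl)

  Adj⇒∈N[] : ∀ {x z} → Adj G x z → z ∈ N[ G ] x
  Adj⇒∈N[] = ∈N[]⁺ ∘ inj₂

  N[]-injective : Identifiable G → ∀ {x y} → N[ G ] x ≡ N[ G ] y → x ≡ y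
  N[]-injective (noTwins , _) {x} {y} N≡ = decidable-stable (x ≟ y) λ x≢y → noTwins x y x≢y N≡

  Leaf : Fin n → Fin n → Set
  Leaf x s = Adj G x s × (∀ z → Adj G x z → z ≡ s)

  Leaf? : ∀ x s → Dec (Leaf x s)
  Leaf? x s = Adj? x s ×-dec all? λ z → Adj? x z →-dec (z ≟ s)

  leaf? : ∀ x → Dec (∃ (Leaf x))
  leaf? x = any? (Leaf? x)

  other-neighbour : ∀ {x u} → ¬ ∃ (Leaf x) → Adj G x u → ∃ λ z → z ≢ u × Adj G x z
  other-neighbour {x} {u} notLeaf xu with any? (λ z → ¬? (z ≟ u) ×-dec Adj? x z)
  ... | yes found = found
  ... | no none   = contradiction (u , xu , only-u) notLeaf
    where
    only-u : ∀ z → Adj G x z → z ≡ u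
    only-u z xz = decidable-stable (z ≟ u) λ z≢u → none (z , z≢u , xz)

  support-not-leaf : Identifiable G → ∀ {l s} → Leaf l s → ¬ ∃ (Leaf s)
  support-not-leaf idf {l} {s} (ls , onlyS) (t , _ , onlyT) = Adj-irrefl (subst (Adj G l) (sym l≡s) ls)
    where
    l≡t : l ≡ t
    l≡t = onlyT l (Adj-sym ls)
    N[l]⊆N[s] : N[ G ] l ⊆ N[ G ] s
    N[l]⊆N[s] z∈ with ∈N[]⁻ z∈
    ... | inj₁ refl = Adj⇒∈N[] (Adj-sym ls)
    ... | inj₂ lz   = subst (_∈ N[ G ] s) (sym (onlyS _ lz)) ∈N[]-refl
    N[s]⊆N[l] : N[ G ] s ⊆ N[ G ] l
    N[s]⊆N[l] z∈ with ∈N[]⁻ z∈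
    ... | inj₁ refl = Adj⇒∈N[] ls
    ... | inj₂ sz   = subst (_∈ N[ G ] l) (trans l≡t (sym (onlyT _ sz))) ∈N[]-refl
    l≡s : l ≡ s
    l≡s = N[]-injective idf (⊆-antisym N[l]⊆N[s] N[s]⊆N[l])

  closed-under-Adj⇒universal : Connected G → (P : Fin n → Set) → (∀ {a b} → P a → Adj G a b → P b) →
                               ∀ {x} → P x → ∀ y → P y
  closed-under-Adj⇒universal connected P closed {x} px y = along (connected x y) px
    where
    along : ∀ {a b} → Reach G a b → P a → P b
    along here         pa = pa
    along (step ab r) pa = along r (closed pa ab)

  AgreeOff : Fin n → Fin n → Fin n → Set
  AgreeOff v x y = ∀ {z} → z ≢ v → z ∈ N[ G ] x → z ∈ N[ G ] y

  AgreeOff⇒⊆ : ∀ {v x y} → AgreeOff v x y → (v ∈ N[ G ] x → v ∈ N[ G ] y) → N[ G ] x ⊆ N[ G ] y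
  AgreeOff⇒⊆ {v} x→y v→ {z} z∈ with z ≟ v
  ... | yes refl = v→ z∈
  ... | no z≢v   = x→y z≢v z∈

  ∁⁅⁆-separating : ∀ {v} → (∀ {x y} → x ≢ y → AgreeOff v x y → AgreeOff v y x → ⊥) →
                   IsSeparatingCode G (∁ ⁅ v ⁆)
  ∁⁅⁆-separating {v} separate x y x≢y I≡ = separate x≢y (agree I≡) (agree (sym I≡))
    where
    agree : ∀ {x y} → I G (∁ ⁅ v ⁆) x ≡ I G (∁ ⁅ v ⁆) y → AgreeOff v x y
    agree I≡ z≢v z∈ = proj₁ (x∈p∩q⁻ _ _ (subst (_ ∈_) I≡ (x∈p∩q⁺ (z∈ , ∈∁⁅⁆ z≢v))))

  ∁⁅⁆-totalDominating : ∀ {v} → (∀ x → ∃ λ w → w ≢ v × Adj G x w) → IsTotalDominating G (∁ ⁅ v ⁆)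
  ∁⁅⁆-totalDominating dominate x = let w , w≢v , xw = dominate x in w , ∈∁⁅⁆ w≢v , xw

  SupportOfDegree≤2 : Set
  SupportOfDegree≤2 = ∃ λ l → ∃ λ s → ∃ λ w → Leaf l s × (∀ z → Adj G s z → z ≡ l ⊎ z ≡ w)

  supportOfDegree≤2? : Dec SupportOfDegree≤2
  supportOfDegree≤2? = any? λ l → any? λ s → any? λ w →
    Leaf? l s ×-dec all? λ z → Adj? s z →-dec ((z ≟ l) ⊎-dec (z ≟ w))

  leaf-unseparated⇒SupportOfDegree≤2 : ∀ {v x y s} → Leaf x s → x ≢ y → AgreeOff v x y → AgreeOff v y x →
                                       SupportOfDegree≤2
  leaf-unseparated⇒SupportOfDegree≤2 {v} {x} {y} {s} leaf@(_ , onlyS) x≢y x→y y→x =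
    x , s , v , leaf , s-nbrs
    where
    y≡s : y ≡ s
    y≡s with y ≟ v
    ... | no y≢v with ∈N[]⁻ (y→x y≢v ∈N[]-refl)
    ...   | inj₁ y≡x = contradiction (sym y≡x) x≢y
    ...   | inj₂ xy  = onlyS y xy
    y≡s | yes refl with ∈N[]⁻ (x→y x≢y ∈N[]-refl)
    ...   | inj₁ x≡y = contradiction x≡y x≢y
    ...   | inj₂ yx  = onlyS y (Adj-sym yx)
    s-nbrs : ∀ z → Adj G s z → z ≡ x ⊎ z ≡ v
    s-nbrs z sz with z ≟ v
    ... | yes z≡v = inj₂ z≡v
    ... | no z≢v with ∈N[]⁻ (y→x z≢v (subst (λ t → z ∈ N[ G ] t) (sym y≡s) (Adj⇒∈N[] sz)))
    ...   | inj₁ z≡x = inj₁ z≡x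
    ...   | inj₂ xz  = contradiction (subst (Adj G s) (onlyS z xz) sz) Adj-irrefl

module _ {n : ℕ} (l s w : Fin n) where

  OneOf3 : Fin n → Set
  OneOf3 a = a ≡ l ⊎ a ≡ s ⊎ a ≡ w

  covered-by-3⇒≤3 : (∀ a → OneOf3 a) → n ≤ 3
  covered-by-3⇒≤3 cover = injective⇒≤ {f = index ∘ cover} λ {a} {b} e →
    trans (sym (name (cover a))) (trans (cong pick e) (name (cover b)))
    where
    pick : Fin 3 → Fin n
    pick 0F = l
    pick 1F = s
    pick 2F = w
    index : ∀ {a} → OneOf3 a → Fin 3
    index (inj₁ _)        = 0F
    index (inj₂ (inj₁ _)) = 1F
    index (inj₂ (inj₂ _)) = 2F
    name : ∀ {a} (p : OneOf3 a) → pick (index p) ≡ a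
    name (inj₁ refl)        = refl
    name (inj₂ (inj₁ refl)) = refl
    name (inj₂ (inj₂ refl)) = refl

module _ {n : ℕ} (G : Graph n) (connected : Connected G) (idf : Identifiable G) (3<n : 3 < n)
         {l s w : Fin n} (leaf : Leaf G l s) (s-nbrs : ∀ z → Adj G s z → z ≡ l ⊎ z ≡ w) where

  private
    ls : Adj G l s
    ls = proj₁ leaf
    onlyS : ∀ z → Adj G l z → z ≡ s
    onlyS = proj₂ leaf

  leaf-component-absurd : (∀ b → Adj G w b → OneOf3 l s w b) → ⊥
  leaf-component-absurd w-nbrs = <⇒≱ 3<n (covered-by-3⇒≤3 l s w
    (closed-under-Adj⇒universal G connected (OneOf3 l s w) closed (inj₁ refl)))
    where
    closed : ∀ {a b} → OneOf3 l s w a → Adj G a b → OneOf3 l s w b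
    closed (inj₁ refl)        ab = inj₂ (inj₁ (onlyS _ ab))
    closed (inj₂ (inj₁ refl)) ab = map₂ inj₂ (s-nbrs _ ab)
    closed (inj₂ (inj₂ refl)) ab = w-nbrs _ ab

  nbrs-of-w : AgreeOff G l w s → l ∉ N[ G ] w → ∀ b → Adj G w b → OneOf3 l s w b
  nbrs-of-w w→s l∉w b wb with b ≟ l
  ... | yes refl = contradiction (Adj⇒∈N[] G wb) l∉w
  ... | no b≢l with ∈N[]⁻ G (w→s b≢l (Adj⇒∈N[] G wb))
  ...   | inj₁ b≡s = inj₂ (inj₁ b≡s)
  ...   | inj₂ sb  = map₂ inj₂ (s-nbrs b sb)

  l∉N[]⇒≢l : ∀ {y} → l ∉ N[ G ] y → y ≢ l
  l∉N[]⇒≢l l∉y refl = l∉y (∈N[]-refl G)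

  l∉N[]⇒≢s : ∀ {y} → l ∉ N[ G ] y → y ≢ s
  l∉N[]⇒≢s l∉y refl = l∉y (Adj⇒∈N[] G (Adj-sym G ls))

  -- x must be l or s, and then y is forced to be w, with {l, s, w} closed under adjacency
  unpinned-absurd : ∀ {x y} → AgreeOff G l y x → l ∈ N[ G ] x → l ∉ N[ G ] y → ⊥
  unpinned-absurd {x} {y} y→x l∈x l∉y with ∈N[]⁻ G l∈x | ∈N[]⁻ G (y→x (l∉N[]⇒≢l l∉y) (∈N[]-refl G))
  ... | inj₁ refl | inj₁ y≡l = l∉N[]⇒≢l l∉y y≡l
  ... | inj₁ refl | inj₂ ly  = l∉N[]⇒≢s l∉y (onlyS y ly)
  ... | inj₂ xl   | y∼x with onlyS x (Adj-sym G xl)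
  ...   | refl with y∼x
  ...     | inj₁ y≡s = l∉N[]⇒≢s l∉y y≡s
  ...     | inj₂ sy with s-nbrs y sy
  ...       | inj₁ y≡l = l∉N[]⇒≢l l∉y y≡l
  ...       | inj₂ refl = leaf-component-absurd (nbrs-of-w y→x l∉y)

  leaf-pinned : ∀ {x y} → AgreeOff G l y x → l ∈ N[ G ] x → l ∈ N[ G ] y
  leaf-pinned {y = y} y→x l∈x = decidable-stable (l ∈? N[ G ] y) (unpinned-absurd y→x l∈x)

  lowSupport-code : IsTDIdCode G (∁ ⁅ l ⁆)
  lowSupport-code = ∁⁅⁆-separating G separate , ∁⁅⁆-totalDominating G dominate
    where
    separate : ∀ {x y} → x ≢ y → AgreeOff G l x y → AgreeOff G l y x → ⊥
    separate x≢y x→y y→x = x≢y (N[]-injective G idf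
      (⊆-antisym (AgreeOff⇒⊆ G x→y (leaf-pinned y→x)) (AgreeOff⇒⊆ G y→x (leaf-pinned x→y))))
    dominate : ∀ x → ∃ λ u → u ≢ l × Adj G x u
    dominate x with proj₂ idf x
    ... | u , xu with u ≟ l
    ...   | no u≢l = u , u≢l , xu
    ...   | yes refl with onlyS x (Adj-sym G xu)
    ...     | refl = other-neighbour G (support-not-leaf G idf leaf) (Adj-sym G ls)

module _ {n : ℕ} (G : Graph (suc n)) (idf : Identifiable G) (noLowSupport : ¬ SupportOfDegree≤2 G) where

  -- Leaves get the open neighbourhood of their support: it differs from the support's own
  -- closed neighbourhood only at the support, so a removable coordinate is never a support vertex.
  profile : Fin (suc n) → Subset (suc n)
  profile x with leaf? G x
  ... | yes (s , _) = N⟨ G ⟩ s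
  ... | no _        = N[ G ] x

  profile-leaf : ∀ {x s} → Leaf G x s → profile x ≡ N⟨ G ⟩ s
  profile-leaf {x} leaf with leaf? G x
  ... | yes (_ , leaf′) = cong (N⟨ G ⟩) (sym (proj₂ leaf′ _ (proj₁ leaf)))
  ... | no notLeaf      = contradiction (_ , leaf) notLeaf

  profile-nonleaf : ∀ {x} → ¬ ∃ (Leaf G x) → profile x ≡ N[ G ] x
  profile-nonleaf {x} notLeaf with leaf? G x
  ... | yes isLeaf = contradiction isLeaf notLeaf
  ... | no _       = refl

  module _ {v : Fin (suc n)} (removable : RemovableAt profile v) where

    removable≢support : ∀ {x s} → Leaf G x s → v ≢ s
    removable≢support {x} {s} leaf refl = Adj-irrefl G (∈N⟨⟩⁻ G (subst (s ∈_) (sym N⟨s⟩≡N[s]) (∈N[]-refl G)))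
      where
      open ≡-Reasoning
      s-profile : profile s ≡ N[ G ] s
      s-profile = profile-nonleaf (support-not-leaf G idf leaf)
      open→closed : ∀ {z} → z ≢ s → z ∈ N⟨ G ⟩ s → z ∈ N[ G ] s
      open→closed _ z∈ = Adj⇒∈N[] G (∈N⟨⟩⁻ G z∈)
      closed→open : ∀ {z} → z ≢ s → z ∈ N[ G ] s → z ∈ N⟨ G ⟩ s
      closed→open z≢s z∈ with ∈N[]⁻ G z∈
      ... | inj₁ z≡s = contradiction z≡s z≢s
      ... | inj₂ sz  = ∈N⟨⟩⁺ G sz
      N⟨s⟩≡N[s] : N⟨ G ⟩ s ≡ N[ G ] s
      N⟨s⟩≡N[s] = begin
        N⟨ G ⟩ s   ≡⟨ sym (profile-leaf leaf) ⟩
        profile x  ≡⟨ removable x s (begin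
                        removeAt (profile x) s   ≡⟨ cong (λ p → removeAt p s) (profile-leaf leaf) ⟩
                        removeAt (N⟨ G ⟩ s) s    ≡⟨ removeAt-≡ s open→closed closed→open ⟩
                        removeAt (N[ G ] s) s    ≡⟨ cong (λ p → removeAt p s) (sym s-profile) ⟩
                        removeAt (profile s) s   ∎) ⟩
        profile s  ≡⟨ s-profile ⟩
        N[ G ] s   ∎

    nonleaves-separated : ∀ {x y} → ¬ ∃ (Leaf G x) → ¬ ∃ (Leaf G y) →
                          AgreeOff G v x y → AgreeOff G v y x → x ≡ y
    nonleaves-separated {x} {y} x-nonleaf y-nonleaf x→y y→x = N[]-injective G idf (begin
      N[ G ] x   ≡⟨ sym (profile-nonleaf x-nonleaf) ⟩
      profile x  ≡⟨ removable x y (begin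
                      removeAt (profile x) v   ≡⟨ cong (λ p → removeAt p v) (profile-nonleaf x-nonleaf) ⟩
                      removeAt (N[ G ] x) v    ≡⟨ removeAt-≡ v x→y y→x ⟩
                      removeAt (N[ G ] y) v    ≡⟨ cong (λ p → removeAt p v) (sym (profile-nonleaf y-nonleaf)) ⟩
                      removeAt (profile y) v   ∎) ⟩
      profile y  ≡⟨ profile-nonleaf y-nonleaf ⟩
      N[ G ] y   ∎)
      where open ≡-Reasoning

    removable-code : IsTDIdCode G (∁ ⁅ v ⁆)
    removable-code = ∁⁅⁆-separating G separate , ∁⁅⁆-totalDominating G dominate
      where
      separate : ∀ {x y} → x ≢ y → AgreeOff G v x y → AgreeOff G v y x → ⊥
      separate {x} {y} x≢y x→y y→x with leaf? G x | leaf? G y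
      ... | yes (_ , leaf) | _ = noLowSupport (leaf-unseparated⇒SupportOfDegree≤2 G leaf x≢y x→y y→x)
      ... | no _ | yes (_ , leaf) = noLowSupport (leaf-unseparated⇒SupportOfDegree≤2 G leaf (x≢y ∘ sym) y→x x→y)
      ... | no x-nonleaf | no y-nonleaf = x≢y (nonleaves-separated x-nonleaf y-nonleaf x→y y→x)
      dominate : ∀ x → ∃ λ u → u ≢ v × Adj G x u
      dominate x with leaf? G x
      ... | yes (s , leaf) = s , removable≢support leaf ∘ sym , proj₁ leaf
      ... | no notLeaf with proj₂ idf x
      ...   | u , xu with u ≟ v
      ...     | no u≢v  = u , u≢v , xu
      ...     | yes refl = other-neighbour G notLeaf xu

  noLowSupport-code : ∃ λ v → IsTDIdCode G (∁ ⁅ v ⁆)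
  noLowSupport-code = let v , removable = bondy Bool._≟_ n profile ≤-refl in v , removable-code removable

punctured-code : ∀ {n} (G : Graph (suc n)) → Connected G → Identifiable G → 3 < suc n →
                 ∃ λ v → IsTDIdCode G (∁ ⁅ v ⁆)
punctured-code G connected idf 3<n with supportOfDegree≤2? G
... | yes (l , _ , _ , leaf , s-nbrs) = l , lowSupport-code G connected idf 3<n leaf s-nbrs
... | no noLowSupport                 = noLowSupport-code G idf noLowSupport

-- Graphs of order at most three

¬identifiable-order1 : (G : Graph 1) → ¬ Identifiable G
¬identifiable-order1 G (_ , hasNeighbour) with hasNeighbour 0F
... | 0F , loop = Adj-irrefl G loop

¬identifiable-order2 : (G : Graph 2) → ¬ Identifiable G
¬identifiable-order2 G (noTwins , hasNeighbour) with hasNeighbour 0F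
... | 0F , loop = Adj-irrefl G loop
... | 1F , edge = noTwins 0F 1F (λ ()) (⊆-antisym N[0]⊆N[1] N[1]⊆N[0])
  where
  N[0]⊆N[1] : N[ G ] 0F ⊆ N[ G ] 1F
  N[0]⊆N[1] {0F} _ = Adj⇒∈N[] G (Adj-sym G edge)
  N[0]⊆N[1] {1F} _ = ∈N[]-refl G
  N[1]⊆N[0] : N[ G ] 1F ⊆ N[ G ] 0F
  N[1]⊆N[0] {0F} _ = ∈N[]-refl G
  N[1]⊆N[0] {1F} _ = Adj⇒∈N[] G edge

⊤-isTDIdCode : ∀ {n} (G : Graph n) → Identifiable G → IsTDIdCode G ⊤
⊤-isTDIdCode G (noTwins , hasNeighbour) =
  (λ x y x≢y I≡ → noTwins x y x≢y (trans (sym (∩-identityʳ _)) (trans I≡ (∩-identityʳ _)))) ,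
  (λ x → let u , xu = hasNeighbour x in u , ∈⊤ , xu)

module _ {n : ℕ} {G H : Graph n} (same-adj : ∀ u v → adj G u v ≡ adj H u v) where

  N[]-same : ∀ x → N[ G ] x ≡ N[ H ] x
  N[]-same x = tabulate-cong λ u → cong (⌊ u ≟ x ⌋ ∨_) (same-adj x u)

  identifiable-same : Identifiable G → Identifiable H
  identifiable-same (noTwins , hasNeighbour) =
    (λ x y x≢y N≡ → noTwins x y x≢y (trans (N[]-same x) (trans N≡ (sym (N[]-same y))))) ,
    (λ x → let u , xu = hasNeighbour x in u , trans (sym (same-adj x u)) xu)

  isTDIdCode-same : ∀ {C} → IsTDIdCode G C → IsTDIdCode H C
  isTDIdCode-same (separating , dominating) =
    (λ x y x≢y I≡ → separating x y x≢y (trans (I-same x) (trans I≡ (sym (I-same y))))) ,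
    (λ x → let u , u∈C , xu = dominating x in u , u∈C , trans (sym (same-adj x u)) xu)
    where
    I-same : ∀ {C} x → I G C x ≡ I H C x
    I-same {C} x = cong (_∩ C) (N[]-same x)

  ≅-same : ∀ {m} {K : Graph m} → H ≅ K → G ≅ K
  ≅-same (f , adj≡) = f , λ u v → trans (same-adj u v) (adj≡ u v)

graph3 : (e01 e02 e12 : Bool) → Graph 3
graph3 e01 e02 e12 = record { adj = table ; sym = table-sym ; irrefl = table-irrefl }
  where
  table : Fin 3 → Fin 3 → Bool
  table 0F 1F = e01
  table 1F 0F = e01
  table 0F 2F = e02
  table 2F 0F = e02
  table 1F 2F = e12
  table 2F 1F = e12
  table _  _  = false
  table-sym : ∀ u v → table u v ≡ table v u
  table-sym 0F 0F = refl
  table-sym 0F 1F = refl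
  table-sym 0F 2F = refl
  table-sym 1F 0F = refl
  table-sym 1F 1F = refl
  table-sym 1F 2F = refl
  table-sym 2F 0F = refl
  table-sym 2F 1F = refl
  table-sym 2F 2F = refl
  table-irrefl : ∀ v → table v v ≡ false
  table-irrefl 0F = refl
  table-irrefl 1F = refl
  table-irrefl 2F = refl

adj-graph3 : (G : Graph 3) → ∀ u v → adj G u v ≡ adj (graph3 (adj G 0F 1F) (adj G 0F 2F) (adj G 1F 2F)) u v
adj-graph3 G 0F 0F = irrefl G 0F
adj-graph3 G 0F 1F = refl
adj-graph3 G 0F 2F = refl
adj-graph3 G 1F 0F = Graph.sym G 1F 0F
adj-graph3 G 1F 1F = irrefl G 1F
adj-graph3 G 1F 2F = refl
adj-graph3 G 2F 0F = Graph.sym G 2F 0F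
adj-graph3 G 2F 1F = Graph.sym G 2F 1F
adj-graph3 G 2F 2F = irrefl G 2F

≅P3-by-evaluation : (H : Graph 3) (π : Permutation 3 3) →
  True (all? λ u → all? λ v → adj H u v Bool.≟ adj P3 (π ⟨$⟩ʳ u) (π ⟨$⟩ʳ v)) →
  H ≅ P3
≅P3-by-evaluation H π same = π , toWitness same

-- A code missing a leaf of P3 does not separate the other leaf from the centre,
-- and one missing the centre does not dominate the leaves.
order3 : ∀ e01 e02 e12 → Identifiable (graph3 e01 e02 e12) →
         (graph3 e01 e02 e12 ≅ P3) × (∀ C → IsTDIdCode (graph3 e01 e02 e12) C → 3 ≤ ∣ C ∣)
order3 false false false (_ , hasNeighbour) = case hasNeighbour 0F of λ { (0F , ()) ; (1F , ()) ; (2F , ()) }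
order3 true  false false (_ , hasNeighbour) = case hasNeighbour 2F of λ { (0F , ()) ; (1F , ()) ; (2F , ()) }
order3 false true  false (_ , hasNeighbour) = case hasNeighbour 1F of λ { (0F , ()) ; (1F , ()) ; (2F , ()) }
order3 false false true  (_ , hasNeighbour) = case hasNeighbour 0F of λ { (0F , ()) ; (1F , ()) ; (2F , ()) }
order3 true  true  true  (noTwins , _)      = contradiction refl (noTwins 0F 1F (λ ()))
order3 true  false true  _ = ≅P3-by-evaluation (graph3 true false true) id _ , lower-bound
  where
  lower-bound : ∀ C → IsTDIdCode (graph3 true false true) C → 3 ≤ ∣ C ∣
  lower-bound (true  ∷ true  ∷ true  ∷ []) _                = ≤-refl
  lower-bound (false ∷ _     ∷ _     ∷ []) (separating , _) = contradiction refl (separating 1F 2F (λ ()))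
  lower-bound (true  ∷ true  ∷ false ∷ []) (separating , _) = contradiction refl (separating 0F 1F (λ ()))
  lower-bound (true  ∷ false ∷ _     ∷ []) (_ , dominating) =
    case dominating 0F of λ { (0F , _ , ()) ; (1F , there () , _) ; (2F , _ , ()) }
order3 true  true  false _ = ≅P3-by-evaluation (graph3 true true false) (transpose 0F 1F) _ , lower-bound
  where
  lower-bound : ∀ C → IsTDIdCode (graph3 true true false) C → 3 ≤ ∣ C ∣
  lower-bound (true  ∷ true  ∷ true  ∷ []) _                = ≤-refl
  lower-bound (true  ∷ false ∷ _     ∷ []) (separating , _) = contradiction refl (separating 0F 2F (λ ()))
  lower-bound (true  ∷ true  ∷ false ∷ []) (separating , _) = contradiction refl (separating 0F 1F (λ ()))
  lower-bound (false ∷ _     ∷ _     ∷ []) (_ , dominating) =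
    case dominating 1F of λ { (0F , () , _) ; (1F , _ , ()) ; (2F , _ , ()) }
order3 false true  true  _ = ≅P3-by-evaluation (graph3 false true true) (transpose 1F 2F) _ , lower-bound
  where
  lower-bound : ∀ C → IsTDIdCode (graph3 false true true) C → 3 ≤ ∣ C ∣
  lower-bound (true  ∷ true  ∷ true  ∷ []) _                = ≤-refl
  lower-bound (false ∷ _     ∷ _     ∷ []) (separating , _) = contradiction refl (separating 1F 2F (λ ()))
  lower-bound (true  ∷ false ∷ _     ∷ []) (separating , _) = contradiction refl (separating 0F 2F (λ ()))
  lower-bound (true  ∷ true  ∷ false ∷ []) (_ , dominating) =
    case dominating 0F of λ { (0F , _ , ()) ; (1F , _ , ()) ; (2F , there (there ()) , _) }

module _ (G : Graph 3) (idf : Identifiable G) where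

  private
    e01 e02 e12 : Bool
    e01 = adj G 0F 1F
    e02 = adj G 0F 2F
    e12 = adj G 1F 2F
    H : Graph 3
    H = graph3 e01 e02 e12
    same-adj : ∀ u v → adj G u v ≡ adj H u v
    same-adj = adj-graph3 G
    facts : (H ≅ P3) × (∀ C → IsTDIdCode H C → 3 ≤ ∣ C ∣)
    facts = order3 e01 e02 e12 (identifiable-same {G = G} {H = H} same-adj idf)

  order3-≅P3 : G ≅ P3
  order3-≅P3 = ≅-same {G = G} {H = H} same-adj {K = P3} (proj₁ facts)

  order3-lower-bound : ∀ C → IsTDIdCode G C → 3 ≤ ∣ C ∣
  order3-lower-bound C code = proj₂ facts C (isTDIdCode-same {G = G} {H = H} same-adj code)

proposition1 : ∀ (n : ℕ) (G : Graph n) → Connected G → Identifiable G →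
    (¬ (G ≅ P3) → ∃ λ (C : Subset n) → IsTDIdCode G C × ∣ C ∣ ≤ n ∸ 1)
    × (G ≅ P3 → (∃ λ (C : Subset n) → IsTDIdCode G C × ∣ C ∣ ≡ 3)
                × (∀ (C : Subset n) → IsTDIdCode G C → 3 ≤ ∣ C ∣))
proposition1 0 G _ _ =
  (λ _ → [] , ((λ ()) , (λ ())) , z≤n) , λ G≅P3 → contradiction (↔⇒≡ (proj₁ G≅P3)) λ ()
proposition1 1 G _ idf = contradiction idf (¬identifiable-order1 G)
proposition1 2 G _ idf = contradiction idf (¬identifiable-order2 G)
proposition1 3 G _ idf =
  (λ G≇P3 → contradiction (order3-≅P3 G idf) G≇P3) ,
  λ _ → (⊤ , ⊤-isTDIdCode G idf , ∣⊤∣≡n 3) , order3-lower-bound G idf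
proposition1 (suc (suc (suc (suc k)))) G connected idf =
  (λ _ → let v , code = punctured-code G connected idf (m≤m+n 4 k)
         in ∁ ⁅ v ⁆ , code , ≤-reflexive (∣∁⁅⁆∣ v)) ,
  λ G≅P3 → contradiction (↔⇒≡ (proj₁ G≅P3)) λ ()
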